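{- Let $n\ge 1$. There is a bijection $\Phi_n$ from the set $\mathrm{R2}\delta_n$ of rook placements on the double staircase $2\delta_n$ to the set $\mathcal{T}_{n+1}$ of increasing binary trees with vertex set $\{1,\ldots,n+1\}$ such that, for every $R\in\mathrm{R2}\delta_n$ and every $i\in\{1,\ldots,n\}$, the following hold: - the $i$-th block of $R$ has a rook in both of its columns if and only if vertex $i$ of $\Phi_n(R)$ has two children; - the $i$-th block of $R$ has no rook in either column if and only if vertex $i$ of $\Phi_n(R)$ has no children; - the $i$-th block of $R$ has a rook in its left column but none in its right column if and only if vertex $i$ of $\Phi_n(R)$ has a left child but no right child; - the $i$-th block of $R$ has a rook in its right column but none in its left column if and only if vertex $i$ of $\Phi_n(R)$ has a right child but no left child.
   Context: The double staircase $2\delta_n$ is the Young diagram, in French notation, of the partition $(2n,2(n-1),\ldots,2)$. Its rows are numbered $1,\ldots,n$ from top to bottom, so that row $j$ has $2j$ cells, and its columns are numbered $1,\ldots,2n$ from left to right. A block of a Young diagram is a maximal collection of columns of the same height. For $2\delta_n$, the blocks are the pairs of columns $\{2i-1,2i\}$ for $i=1,\ldots,n$, and they are indexed from left to right. The $i$-th block has height $n-i+1$ and occupies rows $i,\ldots,n$. A rook placement on $2\delta_n$ is a placement of $n$ rooks in cells of $2\delta_n$ with exactly one rook in each row and at most one rook in each column; $\mathrm{R2}\delta_n$ denotes the set of these placements. An increasing binary tree on $m$ vertices is a rooted tree whose vertices carry distinct labels from $\{1,\ldots,m\}$, in which each vertex has at most one left child and at most one right child, and in which every child has a larger label than its parent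 (so the root is $1$). $\mathcal{T}_m$ denotes the set of these trees. -}

module Defs where

open import Data.Nat using (ℕ; zero; suc; _+_; _*_; _<_; _≤_)
open import Data.Fin using (Fin; toℕ)
open import Data.Vec using (Vec; lookup)
open import Data.List using (List; map; upTo)
open import Data.List.Relation.Binary.Permutation.Propositional using (_↭_)
open import Data.Product using (Σ; _×_; ∃; ∃-syntax)
open import Data.Unit using (⊤)
open import Relation.Nullary using (¬_)
open import Relation.Binary.PropositionalEquality using (_≡_)

-- A placement is a vector v : Vec (Fin (2n)) n; entry j (0-based) is the
-- 0-based column of the rook in row j+1 (rows numbered top to bottom,
-- row j+1 has 2(j+1) cells, i.e. 0-based columns 0 .. 2(j+1)-1).

InDiagram : ∀ {n} → Vec (Fin (2 * n)) n → Set
InDiagram {n} v = ∀ (j : Fin n) → toℕ (lookup v j) < 2 * suc (toℕ j)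

AtMostOnePerColumn : ∀ {n} → Vec (Fin (2 * n)) n → Set
AtMostOnePerColumn {n} v = ∀ (i j : Fin n) → lookup v i ≡ lookup v j → i ≡ j

IsRookPlacement : ∀ {n} → Vec (Fin (2 * n)) n → Set
IsRookPlacement v = InDiagram v × AtMostOnePerColumn v

R2δ : ℕ → Set
R2δ n = Σ (Vec (Fin (2 * n)) n) IsRookPlacement

RookInColumn : ∀ {n} → Vec (Fin (2 * n)) n → ℕ → Set
RookInColumn {n} v c = ∃[ j ] toℕ (lookup v j) ≡ c

-- the block with 0-based index k (paper's block k+1) consists of the
-- 0-based columns 2k (left) and 2k+1 (right).
BlockLeft BlockRight : ∀ {n} → Vec (Fin (2 * n)) n → ℕ → Set
BlockLeft v k = RookInColumn v (2 * k)
BlockRight v k = RookInColumn v (suc (2 * k))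

data Tree : Set where
  leaf : Tree
  node : Tree → ℕ → Tree → Tree

data IsNode : Tree → Set where
  isNode : ∀ l a r → IsNode (node l a r)

labels : Tree → List ℕ
labels leaf = Data.List.[]
labels (node l a r) = labels l Data.List.++ (a Data.List.∷ labels r)

Above : ℕ → Tree → Set
Above a leaf = ⊤
Above a (node _ b _) = a < b

Increasing : Tree → Set
Increasing leaf = ⊤
Increasing (node l a r) = Above a l × Above a r × Increasing l × Increasing r

HasVertexSet : ℕ → Tree → Set
HasVertexSet m t = labels t ↭ map suc (upTo m)

IsIncreasingTree : ℕ → Tree → Set
IsIncreasingTree m t = Increasing t × HasVertexSet m t

IBT : ℕ → Set
IBT m = Σ Tree (IsIncreasingTree m)

data NodeAt : Tree → ℕ → Tree → Tree → Set where
  here  : ∀ l i r → NodeAt (node l i r) i l r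
  left  : ∀ {l a r i l' r'} → NodeAt l i l' r' → NodeAt (node l a r) i l' r'
  right : ∀ {l a r i l' r'} → NodeAt r i l' r' → NodeAt (node l a r) i l' r'

TwoChildren : Tree → ℕ → Set
TwoChildren t i = ∃[ l ] ∃[ r ] (NodeAt t i l r × IsNode l × IsNode r)

NoChildren : Tree → ℕ → Set
NoChildren t i = NodeAt t i leaf leaf

OnlyLeftChild : Tree → ℕ → Set
OnlyLeftChild t i = ∃[ l ] (NodeAt t i l leaf × IsNode l)

OnlyRightChild : Tree → ℕ → Set
OnlyRightChild t i = ∃[ r ] (NodeAt t i leaf r × IsNode r)

-- The four block/vertex correspondences for 0-based block index k,
-- i.e. the paper's block k+1 and vertex k+1.

open import Function.Bundles using (_⇔_)

BlockMatchesVertex : ∀ {n} → Vec (Fin (2 * n)) n → Tree → ℕ → Set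
BlockMatchesVertex v t k =
    ((BlockLeft v k × BlockRight v k) ⇔ TwoChildren t (suc k))
  × ((¬ BlockLeft v k × ¬ BlockRight v k) ⇔ NoChildren t (suc k))
  × ((BlockLeft v k × ¬ BlockRight v k) ⇔ OnlyLeftChild t (suc k))
  × ((¬ BlockLeft v k × BlockRight v k) ⇔ OnlyRightChild t (suc k))

-- Build the tree by reading the rows from top to bottom, starting from the single vertex 1:
-- the rook of row j lies in the left or right column of some block q ≤ j, and it attaches the
-- vertex j + 1 as the left or right child of the vertex q, which is already present. That slot
-- is still empty because no earlier rook uses the same column, and j + 1 exceeds every earlier
-- label, so the tree stays increasing. Conversely, in an increasing tree each vertex j + 1 ≥ 2
-- hangs in a unique slot below a smaller vertex q, which names a column of row j, and a tree is
-- determined by which vertex fills each slot; so placement and tree determine each other. By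
-- construction, the rooks in block q record exactly which children vertex q has.

module Submission where

open import Defs
open import Data.Nat using (ℕ; zero; suc; pred; _+_; _*_; _≤_; _<_; z≤n; s≤s; z<s; _≟_)
open import Data.Nat.Properties
open import Data.Bool using (Bool; true; false; not)
open import Data.Bool.Properties using (not-¬)
open import Data.Maybe using (Maybe; just; nothing; maybe′; _<∣>_)
open import Data.Maybe.Properties using (just-injective; ≡-dec)
open import Data.Product using (Σ; _×_; _,_; proj₁; proj₂; ∃; ∃-syntax; ∃₂)
open import Data.Product.Properties using (,-injective)
open import Data.Product.Function.NonDependent.Propositional using (_×-⇔_)
open import Data.Sum using (_⊎_; inj₁; inj₂)
open import Data.Empty using (⊥-elim)
open import Data.Unit using (⊤; tt)
open import Data.List using (List; []; _∷_; _++_; map; upTo; [_])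
open import Data.List.Properties using (upTo-∷ʳ; map-++)
open import Data.List.Membership.Propositional using (_∈_; _∉_)
open import Data.List.Membership.Propositional.Properties
  using (∈-++⁺ˡ; ∈-++⁺ʳ; ∈-++⁻; ∈-map⁺; ∈-map⁻; ∈-upTo⁺; ∈-upTo⁻)
open import Data.List.Relation.Unary.Any using (here; there)
import Data.List.Relation.Unary.All as All
import Data.List.Relation.Unary.All.Properties as All
open import Data.List.Relation.Unary.AllPairs using ([]; _∷_)
open import Data.List.Relation.Unary.Unique.Propositional using (Unique)
import Data.List.Relation.Unary.Unique.Propositional.Properties as Unique
open import Data.List.Relation.Binary.Permutation.Propositional
  using (_↭_; ↭-refl; ↭-reflexive; ↭-sym; ↭-trans; ↭-prep; ↭-swap; ↭⇒↭ₛ)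
open import Data.List.Relation.Binary.Permutation.Propositional.Properties
  using (∈-resp-↭; shift; ++⁺ʳ; ++⁺ˡ; ∷↭∷ʳ)
open import Data.List.Relation.Binary.Permutation.Setoid.Properties using (Unique-resp-↭)
open import Data.Fin as Fin using (Fin; toℕ; fromℕ<)
open import Data.Fin.Properties using (toℕ-injective; toℕ<n; toℕ-fromℕ<)
open import Data.Vec using (Vec; []; _∷_; lookup; tabulate)
open import Data.Vec.Properties using (lookup∘tabulate; tabulate∘lookup; tabulate-cong)
open import Function using (_∘_; case_of_)
open import Function.Bundles using (_⇔_; mk⇔)
open import Function.Construct.Symmetry using (⇔-sym)
open import Function.Construct.Composition using (_⇔-∘_)
open import Function.Related.TypeIsomorphisms using (¬-cong-⇔)
open import Relation.Nullary using (¬_; Dec; yes; no; does)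
open import Relation.Nullary.Decidable using (dec-true; dec-false)
open import Relation.Binary.PropositionalEquality hiding ([_])

column : ℕ → Bool → ℕ
column q false = 2 * q
column q true  = suc (2 * q)

column-injective : ∀ q s q′ s′ → column q s ≡ column q′ s′ → q ≡ q′ × s ≡ s′
column-injective q false q′ false e = *-cancelˡ-≡ q q′ 2 e , refl
column-injective q false q′ true  e = ⊥-elim (even≢odd q q′ e)
column-injective q true  q′ false e = ⊥-elim (even≢odd q′ q (sym e))
column-injective q true  q′ true  e = *-cancelˡ-≡ q q′ 2 (suc-injective e) , refl

column-suc : ∀ q s → column (suc q) s ≡ suc (suc (column q s))
column-suc q false = *-suc 2 q
column-suc q true  = cong suc (*-suc 2 q)

2*q≤column : ∀ q s → 2 * q ≤ column q s
2*q≤column q false = ≤-refl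
2*q≤column q true  = n≤1+n (2 * q)

column<2*[1+q] : ∀ q s → column q s < 2 * suc q
column<2*[1+q] q s = subst (column q s <_) (sym (*-suc 2 q)) (s≤s (column≤ s))
  where
  column≤ : ∀ s → column q s ≤ suc (2 * q)
  column≤ false = n≤1+n (2 * q)
  column≤ true  = ≤-refl

column-surjective : ∀ c → ∃₂ λ q s → c ≡ column q s
column-surjective zero          = 0 , false , refl
column-surjective (suc zero)    = 0 , true , refl
column-surjective (suc (suc c)) with column-surjective c
... | q , s , refl = suc q , s , sym (column-suc q s)

column-decode : ∀ {c j} → c < 2 * suc j → ∃₂ λ q s → q ≤ j × c ≡ column q s
column-decode {c} {j} c<2[1+j] with column-surjective c
... | q , s , refl = q , s , m<1+n⇒m≤n (*-cancelˡ-< 2 q (suc j) (≤-<-trans (2*q≤column q s) c<2[1+j])) , refl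

oneTo : ℕ → List ℕ
oneTo m = map suc (upTo m)

∈-oneTo⁻ : ∀ {x m} → x ∈ oneTo m → ∃ λ y → y < m × x ≡ suc y
∈-oneTo⁻ p with ∈-map⁻ suc p
... | y , y∈ , refl = y , ∈-upTo⁻ y∈ , refl

∈-oneTo⇒positive : ∀ {x m} → x ∈ oneTo m → 0 < x
∈-oneTo⇒positive x∈ with ∈-oneTo⁻ x∈
... | _ , _ , refl = z<s

∈-oneTo⁺ : ∀ {y m} → y < m → suc y ∈ oneTo m
∈-oneTo⁺ y<m = ∈-map⁺ suc (∈-upTo⁺ y<m)

oneTo-unique : ∀ m → Unique (oneTo m)
oneTo-unique m = Unique.map⁺ suc-injective (Unique.upTo⁺ m)

oneTo-suc : ∀ m → oneTo (suc m) ↭ suc m ∷ oneTo m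
oneTo-suc m = subst (_↭ suc m ∷ oneTo m)
  (trans (sym (map-++ suc (upTo m) [ m ])) (cong (map suc) (upTo-∷ʳ m)))
  (↭-sym (∷↭∷ʳ (suc m) (oneTo m)))

_≟ᵐ_ : (m m′ : Maybe ℕ) → Dec (m ≡ m′)
_≟ᵐ_ = ≡-dec _≟_

root : Tree → Maybe ℕ
root leaf         = nothing
root (node _ a _) = just a

side : Bool → Tree → Tree → Tree
side false l r = l
side true  l r = r

side-idem : ∀ s t → side s t t ≡ t
side-idem false t = refl
side-idem true  t = refl

∈-left⁺ : ∀ {x} l a r → x ∈ labels l → x ∈ labels (node l a r)
∈-left⁺ l a r = ∈-++⁺ˡ

∈-root⁺ : ∀ l a r → a ∈ labels (node l a r)
∈-root⁺ l a r = ∈-++⁺ʳ (labels l) (here refl)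

∈-right⁺ : ∀ {x} l a r → x ∈ labels r → x ∈ labels (node l a r)
∈-right⁺ l a r x∈r = ∈-++⁺ʳ (labels l) (there x∈r)

∈-node⁻ : ∀ {x} l a r → x ∈ labels (node l a r) → x ∈ labels l ⊎ x ≡ a ⊎ x ∈ labels r
∈-node⁻ l a r x∈ with ∈-++⁻ (labels l) x∈
... | inj₁ x∈l         = inj₁ x∈l
... | inj₂ (here x≡a)  = inj₂ (inj₁ x≡a)
... | inj₂ (there x∈r) = inj₂ (inj₂ x∈r)

∈-∉⇒≢ : ∀ {x y} {xs : List ℕ} → x ∈ xs → y ∉ xs → x ≢ y
∈-∉⇒≢ x∈ y∉ refl = y∉ x∈

root⇒∈ : ∀ {x} t → root t ≡ just x → x ∈ labels t
root⇒∈ (node l a r) refl = ∈-root⁺ l a r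

∈-side⁺ : ∀ {x} s l a r → x ∈ labels (side s l r) → x ∈ labels (node l a r)
∈-side⁺ false l a r = ∈-left⁺ l a r
∈-side⁺ true  l a r = ∈-right⁺ l a r

isNode-root : ∀ {t} → IsNode t → ∃ λ x → root t ≡ just x
isNode-root (isNode l a r) = a , refl

root⇒isNode : ∀ {t x} → root t ≡ just x → IsNode t
root⇒isNode {node l a r} _ = isNode l a r

¬isNode⇒leaf : ∀ t → ¬ IsNode t → t ≡ leaf
¬isNode⇒leaf leaf         _       = refl
¬isNode⇒leaf (node l a r) ¬isNode = ⊥-elim (¬isNode (isNode l a r))

¬isNode-leaf : ¬ IsNode leaf
¬isNode-leaf ()

Distinct : Tree → Set
Distinct leaf         = ⊤
Distinct (node l a r) = Distinct l × Distinct r × a ∉ labels l × a ∉ labels r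
                      × (∀ {x} → x ∈ labels l → x ∉ labels r)

Unique-++⁻ : ∀ (xs : List ℕ) {ys} → Unique (xs ++ ys) →
  Unique xs × Unique ys × (∀ {x} → x ∈ xs → x ∉ ys)
Unique-++⁻ []       u = [] , u , λ ()
Unique-++⁻ (x ∷ xs) (x∉ ∷ u) with Unique-++⁻ xs u
... | uxs , uys , disjoint = All.++⁻ˡ xs x∉ ∷ uxs , uys , disjoint′
  where
  disjoint′ : ∀ {z} → z ∈ x ∷ xs → z ∉ _
  disjoint′ (here refl) z∈ys = All.lookup (All.++⁻ʳ xs x∉) z∈ys refl
  disjoint′ (there z∈xs)    = disjoint z∈xs

unique⇒distinct : ∀ t → Unique (labels t) → Distinct t
unique⇒distinct leaf         _ = tt
unique⇒distinct (node l a r) u with Unique-++⁻ (labels l) u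
... | ul , a∉r ∷ ur , disjoint =
  unique⇒distinct l ul , unique⇒distinct r ur , (λ a∈l → disjoint a∈l (here refl)) ,
  (λ a∈r → All.lookup a∉r a∈r refl) , (λ x∈l x∈r → disjoint x∈l (there x∈r))

distinct-oneTo : ∀ {t m} → labels t ↭ oneTo m → Distinct t
distinct-oneTo {t} {m} lab =
  unique⇒distinct t (Unique-resp-↭ (setoid ℕ) (↭⇒↭ₛ (↭-sym lab)) (oneTo-unique m))

∈-vertices : ∀ {T j x} → labels T ↭ oneTo (suc j) → x ∈ labels T → ∃ λ q → q ≤ j × x ≡ suc q
∈-vertices lab x∈ with ∈-oneTo⁻ (∈-resp-↭ lab x∈)
... | q , q<1+j , x≡ = q , m<1+n⇒m≤n q<1+j , x≡

nodeAt⇒∈ : ∀ {t a l r} → NodeAt t a l r → a ∈ labels t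
nodeAt⇒∈ (here l a r)          = ∈-root⁺ l a r
nodeAt⇒∈ (left {l} {a} {r} p)  = ∈-left⁺ l a r (nodeAt⇒∈ p)
nodeAt⇒∈ (right {l} {a} {r} p) = ∈-right⁺ l a r (nodeAt⇒∈ p)

nodeAt-⊆ : ∀ {t a l r x} → NodeAt t a l r → x ∈ labels (node l a r) → x ∈ labels t
nodeAt-⊆ (here l a r)          x∈ = x∈
nodeAt-⊆ (left {l} {a} {r} p)  x∈ = ∈-left⁺ l a r (nodeAt-⊆ p x∈)
nodeAt-⊆ (right {l} {a} {r} p) x∈ = ∈-right⁺ l a r (nodeAt-⊆ p x∈)

∈⇒nodeAt : ∀ {t x} → x ∈ labels t → ∃₂ λ l r → NodeAt t x l r
∈⇒nodeAt {node l a r} x∈ with ∈-node⁻ l a r x∈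
... | inj₁ x∈l with ∈⇒nodeAt x∈l
...   | l′ , r′ , p = l′ , r′ , left p
∈⇒nodeAt {node l a r} x∈ | inj₂ (inj₁ refl) = l , r , here l a r
∈⇒nodeAt {node l a r} x∈ | inj₂ (inj₂ x∈r) with ∈⇒nodeAt x∈r
...   | l′ , r′ , p = l′ , r′ , right p

nodeAt-unique : ∀ {t a l r l′ r′} → Distinct t → NodeAt t a l r → NodeAt t a l′ r′ → l ≡ l′ × r ≡ r′
nodeAt-unique _ (here l a r) (here _ _ _) = refl , refl
nodeAt-unique (_ , _ , a∉l , _ , _) (here _ _ _) (left p)  = ⊥-elim (a∉l (nodeAt⇒∈ p))
nodeAt-unique (_ , _ , _ , a∉r , _) (here _ _ _) (right p) = ⊥-elim (a∉r (nodeAt⇒∈ p))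
nodeAt-unique (_ , _ , a∉l , _ , _) (left p)  (here _ _ _) = ⊥-elim (a∉l (nodeAt⇒∈ p))
nodeAt-unique (_ , _ , _ , a∉r , _) (right p) (here _ _ _) = ⊥-elim (a∉r (nodeAt⇒∈ p))
nodeAt-unique (dl , _ , _)          (left p)  (left p′)    = nodeAt-unique dl p p′
nodeAt-unique (_ , dr , _)          (right p) (right p′)   = nodeAt-unique dr p p′
nodeAt-unique (_ , _ , _ , _ , l#r) (left p)  (right p′)   = ⊥-elim (l#r (nodeAt⇒∈ p) (nodeAt⇒∈ p′))
nodeAt-unique (_ , _ , _ , _ , l#r) (right p) (left p′)    = ⊥-elim (l#r (nodeAt⇒∈ p′) (nodeAt⇒∈ p))

nodeAt-increasing : ∀ {t a l r} → Increasing t → NodeAt t a l r → Increasing (node l a r)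
nodeAt-increasing inc              (here _ _ _) = inc
nodeAt-increasing (_ , _ , il , _) (left p)     = nodeAt-increasing il p
nodeAt-increasing (_ , _ , _ , ir) (right p)    = nodeAt-increasing ir p

above⇒< : ∀ {t b x} → Increasing t → Above b t → x ∈ labels t → b < x
above⇒< {node l a r} (al , ar , il , ir) b<a x∈ with ∈-node⁻ l a r x∈
... | inj₁ x∈l        = <-trans b<a (above⇒< il al x∈l)
... | inj₂ (inj₁ refl) = b<a
... | inj₂ (inj₂ x∈r) = <-trans b<a (above⇒< ir ar x∈r)

ChildOf : Tree → ℕ → Bool → ℕ → Set
ChildOf t a s x = ∃₂ λ l r → NodeAt t a l r × root (side s l r) ≡ just x

childOf⇒∈ : ∀ {t a s x} → ChildOf t a s x → x ∈ labels t
childOf⇒∈ {s = s} (l , r , p , e) = nodeAt-⊆ p (∈-side⁺ s l _ r (root⇒∈ (side s l r) e))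

childOf-< : ∀ {t a s x} → Increasing t → ChildOf t a s x → a < x
childOf-< {s = s} inc (l , r , p , e) with nodeAt-increasing inc p
... | al , ar , _ = above-root s al ar e
  where
  above-root : ∀ {a l r x} s → Above a l → Above a r → root (side s l r) ≡ just x → a < x
  above-root {l = node _ _ _} false al _ refl = al
  above-root {r = node _ _ _} true  _ ar refl = ar

childOf-notRoot : ∀ {t a s x} → Distinct t → ChildOf t a s x → root t ≢ just x
childOf-notRoot {s = s} (_ , _ , a∉l , a∉r , _) (l , r , here _ _ _ , e) refl
  with s | root⇒∈ (side s l r) e
... | false | a∈l = a∉l a∈l
... | true  | a∈r = a∉r a∈r
childOf-notRoot (_ , _ , a∉l , _ , _) (l , r , left p , e)  refl = a∉l (childOf⇒∈ (l , r , p , e))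
childOf-notRoot (_ , _ , _ , a∉r , _) (l , r , right p , e) refl = a∉r (childOf⇒∈ (l , r , p , e))

childOf-exists : ∀ {t x} → x ∈ labels t → root t ≢ just x → ∃₂ λ a s → ChildOf t a s x
childOf-exists {node l a r} {x} x∈ x≢root with ∈-node⁻ l a r x∈
... | inj₂ (inj₁ refl) = ⊥-elim (x≢root refl)
... | inj₁ x∈l with root l ≟ᵐ just x
...   | yes e = a , false , l , r , here l a r , e
...   | no ne with childOf-exists x∈l ne
...     | b , s , l′ , r′ , p , e = b , s , l′ , r′ , left p , e
childOf-exists {node l a r} {x} x∈ x≢root | inj₂ (inj₂ x∈r) with root r ≟ᵐ just x
...   | yes e = a , true , l , r , here l a r , e
...   | no ne with childOf-exists x∈r ne
...     | b , s , l′ , r′ , p , e = b , s , l′ , r′ , right p , e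

parent : ℕ → Tree → Maybe (ℕ × Bool)
parent x leaf = nothing
parent x (node l a r) with root l ≟ᵐ just x | root r ≟ᵐ just x
... | yes _ | _     = just (a , false)
... | no _  | yes _ = just (a , true)
... | no _  | no _  = parent x l <∣> parent x r

parent-∉ : ∀ {t x} → x ∉ labels t → parent x t ≡ nothing
parent-∉ {leaf} _ = refl
parent-∉ {node l a r} {x} x∉ with root l ≟ᵐ just x | root r ≟ᵐ just x
... | yes e | _     = ⊥-elim (x∉ (∈-left⁺ l a r (root⇒∈ l e)))
... | no _  | yes e = ⊥-elim (x∉ (∈-right⁺ l a r (root⇒∈ r e)))
... | no _  | no _  rewrite parent-∉ {l} (x∉ ∘ ∈-left⁺ l a r) = parent-∉ {r} (x∉ ∘ ∈-right⁺ l a r)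

childOf⇒parent : ∀ {t a s x} → Distinct t → ChildOf t a s x → parent x t ≡ just (a , s)
childOf⇒parent {node l a r} {s = false} {x} _ (_ , _ , here _ _ _ , e) with root l ≟ᵐ just x
... | yes _  = refl
... | no ne = ⊥-elim (ne e)
childOf⇒parent {node l a r} {s = true} {x} (_ , _ , _ , _ , l#r) (_ , _ , here _ _ _ , e)
  with root l ≟ᵐ just x | root r ≟ᵐ just x
... | yes e′ | _     = ⊥-elim (l#r (root⇒∈ l e′) (root⇒∈ r e))
... | no _   | yes _ = refl
... | no _   | no ne = ⊥-elim (ne e)
childOf⇒parent {node l b r} {x = x} (dl , _ , _ , _ , l#r) (_ , _ , left p , e)
  with root l ≟ᵐ just x | root r ≟ᵐ just x
... | yes e′ | _     = ⊥-elim (childOf-notRoot dl (_ , _ , p , e) e′)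
... | no _   | yes e′ = ⊥-elim (l#r (childOf⇒∈ (_ , _ , p , e)) (root⇒∈ r e′))
... | no _   | no _  rewrite childOf⇒parent dl (_ , _ , p , e) = refl
childOf⇒parent {node l b r} {x = x} (_ , dr , _ , _ , l#r) (_ , _ , right p , e)
  with root l ≟ᵐ just x | root r ≟ᵐ just x
... | yes e′ | _     = ⊥-elim (l#r (root⇒∈ l e′) (childOf⇒∈ (_ , _ , p , e)))
... | no _   | yes e′ = ⊥-elim (childOf-notRoot dr (_ , _ , p , e) e′)
... | no _   | no _
  rewrite parent-∉ {l} (λ x∈l → l#r x∈l (childOf⇒∈ (_ , _ , p , e))) = childOf⇒parent dr (_ , _ , p , e)

childOf-unique : ∀ {t a a′ s s′ x} → Distinct t → ChildOf t a s x → ChildOf t a′ s′ x → a ≡ a′ × s ≡ s′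
childOf-unique d c c′ = ,-injective (just-injective (trans (sym (childOf⇒parent d c)) (childOf⇒parent d c′)))

childOf-at : ∀ {t a l r s x} → Distinct t → NodeAt t a l r → ChildOf t a s x → root (side s l r) ≡ just x
childOf-at d p (_ , _ , p′ , e) with nodeAt-unique d p p′
... | refl , refl = e

childOf-functional : ∀ {t a s x y} → Distinct t → ChildOf t a s x → ChildOf t a s y → x ≡ y
childOf-functional d c@(_ , _ , p , _) c′ = just-injective (trans (sym (childOf-at d p c)) (childOf-at d p c′))

childRoots-ext : ∀ {u u′} → root u ≡ root u′ →
  (∀ {a l r l′ r′} → NodeAt u a l r → NodeAt u′ a l′ r′ → root l ≡ root l′ × root r ≡ root r′) →
  u ≡ u′
childRoots-ext {leaf}       {leaf}          _    _ = refl
childRoots-ext {node l a r} {node l′ .a r′} refl same with same (here l a r) (here l′ a r′)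
... | el , er = cong₂ (λ x y → node x a y)
  (childRoots-ext el (λ p p′ → same (left p) (left p′)))
  (childRoots-ext er (λ p p′ → same (right p) (right p′)))

root-oneTo : ∀ {t m} → Increasing t → labels t ↭ oneTo (suc m) → root t ≡ just 1
root-oneTo {leaf} _ lab with ∈-resp-↭ (↭-sym lab) (∈-oneTo⁺ {0} {suc _} z<s)
... | ()
root-oneTo {node l a r} (al , ar , il , ir) lab
  with ∈-node⁻ l a r (∈-resp-↭ (↭-sym lab) (∈-oneTo⁺ {0} {suc _} z<s))
     | ∈-oneTo⇒positive (∈-resp-↭ lab (∈-root⁺ l a r))
... | inj₂ (inj₁ refl) | _   = refl
... | inj₁ 1∈l         | 0<a = ⊥-elim (<⇒≱ (above⇒< il al 1∈l) 0<a)
... | inj₂ (inj₂ 1∈r)  | 0<a = ⊥-elim (<⇒≱ (above⇒< ir ar 1∈r) 0<a)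

-- Side s of vertex q + 1 is addressed by column q s; in graft c k b t the flag b records
-- whether t itself fills the slot addressed by c, where a new leaf k is hung if it is empty.
isSlot : ℕ → ℕ → Bool → Bool
isSlot c zero    s = false
isSlot c (suc q) s = does (column q s ≟ c)

graft : ℕ → ℕ → Bool → Tree → Tree
graft c k _     (node l a r) = node (graft c k (isSlot c a false) l) a (graft c k (isSlot c a true) r)
graft c k false leaf         = leaf
graft c k true  leaf         = node leaf k leaf

insert : ℕ → ℕ → Tree → Tree
insert c k = graft c k false

isSlot-self : ∀ q s → isSlot (column q s) (suc q) s ≡ true
isSlot-self q s = dec-true (column q s ≟ column q s) refl

isSlot-not : ∀ q s → isSlot (column q s) (suc q) (not s) ≡ false
isSlot-not q s = dec-false (column q (not s) ≟ column q s)
  (λ e → not-¬ refl (sym (proj₂ (column-injective q (not s) q s e))))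

isSlot-other : ∀ {a q} s s′ → a ≢ suc q → isSlot (column q s) a s′ ≡ false
isSlot-other {zero}   s s′ _  = refl
isSlot-other {suc a} {q} s s′ a≢ =
  dec-false (column a s′ ≟ column q s) (λ e → a≢ (cong suc (proj₁ (column-injective a s′ q s e))))

root-insert : ∀ {c k} t → root (insert c k t) ≡ root t
root-insert leaf         = refl
root-insert (node l a r) = refl

isNode-insert⁻ : ∀ {c k} t → IsNode (insert c k t) → IsNode t
isNode-insert⁻ (node l a r) _ = isNode l a r

graft-side : ∀ s {c k} a l r →
  side s (graft c k (isSlot c a false) l) (graft c k (isSlot c a true) r) ≡ graft c k (isSlot c a s) (side s l r)
graft-side false a l r = refl
graft-side true  a l r = refl

nodeAt-graft : ∀ {c k b t a l r} → NodeAt t a l r →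
  NodeAt (graft c k b t) a (graft c k (isSlot c a false) l) (graft c k (isSlot c a true) r)
nodeAt-graft (here l a r) = here _ a _
nodeAt-graft (left p)     = left (nodeAt-graft p)
nodeAt-graft (right p)    = right (nodeAt-graft p)

graft-fills : ∀ {k b t q l r} s → NodeAt t (suc q) l r → side s l r ≡ leaf →
  NodeAt (graft (column q s) k b t) k leaf leaf
graft-fills {k} {q = q} false (here .leaf _ r) refl rewrite isSlot-self q false = left (here leaf k leaf)
graft-fills {k} {q = q} true  (here l _ .leaf) refl rewrite isSlot-self q true  = right (here leaf k leaf)
graft-fills s (left p)  e = left (graft-fills s p e)
graft-fills s (right p) e = right (graft-fills s p e)

graft-increasing : ∀ {c k} b t → Increasing t → (∀ {x} → x ∈ labels t → x < k) → Increasing (graft c k b t)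
graft-increasing false leaf _ _ = tt
graft-increasing true  leaf _ _ = tt , tt , tt , tt
graft-increasing _ (node l a r) (al , ar , il , ir) <k =
  above-graft l al , above-graft r ar ,
  graft-increasing _ l il (<k ∘ ∈-left⁺ l a r) , graft-increasing _ r ir (<k ∘ ∈-right⁺ l a r)
  where
  above-graft : ∀ {b} u → Above a u → Above a (graft _ _ b u)
  above-graft {false} leaf _ = tt
  above-graft {true}  leaf _ = <k (∈-root⁺ l a r)
  above-graft (node _ _ _) a<  = a<

graft-node : ∀ {k b l a r q} s → a ≢ suc q →
  graft (column q s) k b (node l a r) ≡ node (graft (column q s) k false l) a (graft (column q s) k false r)
graft-node s a≢ rewrite isSlot-other s false a≢ | isSlot-other s true a≢ = refl

graft-untouched : ∀ {k q} s t → suc q ∉ labels t → graft (column q s) k false t ≡ t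
graft-untouched s leaf         _  = refl
graft-untouched {k} s (node l a r) q∉ = trans (graft-node {k} {false} s (∈-∉⇒≢ (∈-root⁺ l a r) q∉))
  (cong₂ (λ x y → node x a y) (graft-untouched s l (q∉ ∘ ∈-left⁺ l a r))
                               (graft-untouched s r (q∉ ∘ ∈-right⁺ l a r)))

graft-inLeft : ∀ {k b l a r q} s → Distinct (node l a r) → suc q ∈ labels l →
  graft (column q s) k b (node l a r) ≡ node (graft (column q s) k false l) a r
graft-inLeft {k} {b} {l} {a} {r} s (_ , _ , a∉l , _ , l#r) q∈l =
  trans (graft-node {k} {b} s (≢-sym (∈-∉⇒≢ q∈l a∉l))) (cong (node _ a) (graft-untouched s r (l#r q∈l)))

graft-inRight : ∀ {k b l a r q} s → Distinct (node l a r) → suc q ∈ labels r →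
  graft (column q s) k b (node l a r) ≡ node l a (graft (column q s) k false r)
graft-inRight {k} {b} {l} {a} {r} s (_ , _ , _ , a∉r , l#r) q∈r =
  trans (graft-node {k} {b} s (≢-sym (∈-∉⇒≢ q∈r a∉r)))
        (cong (λ l′ → node l′ a _) (graft-untouched s l (λ q∈l → l#r q∈l q∈r)))

shift-after : ∀ (xs : List ℕ) a k ys → xs ++ a ∷ k ∷ ys ↭ k ∷ xs ++ a ∷ ys
shift-after xs a k ys = ↭-trans (++⁺ˡ xs (↭-swap a k ↭-refl)) (shift k xs (a ∷ ys))

graft-labels : ∀ {k b t q l r} s → Distinct t → NodeAt t (suc q) l r → side s l r ≡ leaf →
  labels (graft (column q s) k b t) ↭ k ∷ labels t
graft-labels {k} {q = q} false (_ , _ , _ , q∉r , _) (here .leaf _ r) refl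
  rewrite isSlot-self q false | isSlot-not q false | graft-untouched {k} false r q∉r = ↭-refl
graft-labels {k} {q = q} true  (_ , _ , q∉l , _ , _) (here l _ .leaf) refl
  rewrite isSlot-self q true | isSlot-not q true | graft-untouched {k} true l q∉l = shift-after (labels l) (suc q) k []
graft-labels {k} {b′} s d@(dl , _) (left {l₀} {b} {r₀} p) e =
  ↭-trans (↭-reflexive (cong labels (graft-inLeft {k} {b′} s d (nodeAt⇒∈ p))))
          (++⁺ʳ (b ∷ labels r₀) (graft-labels s dl p e))
graft-labels {k} {b′} s d@(_ , dr , _) (right {l₀} {b} {r₀} p) e =
  ↭-trans (↭-reflexive (cong labels (graft-inRight {k} {b′} s d (nodeAt⇒∈ p))))
          (↭-trans (++⁺ˡ (labels l₀) (↭-prep b (graft-labels s dr p e)))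
                   (shift-after (labels l₀) b k (labels r₀)))

IsPlacement : (ℕ → ℕ) → ℕ → Set
IsPlacement f n = (∀ i → i < n → f i < 2 * suc i)
                × (∀ i i′ → i < n → i′ < n → f i ≡ f i′ → i ≡ i′)

isPlacement-pred : ∀ {f n} → IsPlacement f (suc n) → IsPlacement f n
isPlacement-pred (bound , inj) =
  (λ i i<n → bound i (m<n⇒m<1+n i<n)) , (λ i i′ i<n i′<n → inj i i′ (m<n⇒m<1+n i<n) (m<n⇒m<1+n i′<n))

-- t fills the slot addressed by c, and holds vertex 2 + i there exactly when the rook of
-- (0-based) row i is in column c.
SlotMatches : (ℕ → ℕ) → ℕ → ℕ → Tree → Set
SlotMatches f j c t = (∀ i → i < j → f i ≡ c → root t ≡ just (2 + i))
                    × (IsNode t → ∃ λ i → i < j × f i ≡ c)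

VertexMatches : (ℕ → ℕ) → ℕ → Tree → ℕ → Set
VertexMatches f j T q = ∃₂ λ l r → NodeAt T (suc q) l r × (∀ s → SlotMatches f j (column q s) (side s l r))

Represents : (ℕ → ℕ) → ℕ → Tree → Set
Represents f j T = Increasing T × labels T ↭ oneTo (suc j) × (∀ q → q ≤ j → VertexMatches f j T q)

build : (ℕ → ℕ) → ℕ → Tree
build f zero    = node leaf 1 leaf
build f (suc j) = insert (f j) (2 + j) (build f j)

build-cong : ∀ {f g} j → (∀ i → i < j → f i ≡ g i) → build f j ≡ build g j
build-cong zero    _  = refl
build-cong (suc j) f≗g =
  cong₂ (λ c t → insert c (2 + j) t) (f≗g j ≤-refl) (build-cong j (λ i → f≗g i ∘ m<n⇒m<1+n))

unoccupied⇒leaf : ∀ {f j c} t → IsPlacement f (suc j) → f j ≡ c →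
  (IsNode t → ∃ λ i → i < j × f i ≡ c) → t ≡ leaf
unoccupied⇒leaf leaf _ _ _ = refl
unoccupied⇒leaf {j = j} (node l a r) (_ , inj) fj≡c occupied with occupied (isNode l a r)
... | i , i<j , fi≡c = ⊥-elim (<-irrefl (inj i j (m<n⇒m<1+n i<j) ≤-refl (trans fi≡c (sym fj≡c))) i<j)

nextRow-slot : ∀ {f j T} → IsPlacement f (suc j) → Represents f j T →
  ∃₂ λ q s → f j ≡ column q s × ∃₂ λ l r → NodeAt T (suc q) l r × side s l r ≡ leaf
nextRow-slot {f} {j} V@(bound , _) (_ , _ , vertex) with column-decode (bound j ≤-refl)
... | q , s , q≤j , fj≡ with vertex q q≤j
...   | l , r , p , matches = q , s , fj≡ , l , r , p , unoccupied⇒leaf (side s l r) V fj≡ (proj₂ (matches s))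

slotMatches-new : ∀ {f j} → IsPlacement f (suc j) → ∀ s → SlotMatches f (suc j) (column (suc j) s) leaf
slotMatches-new {f} {j} (bound , _) s = beyond , λ ()
  where
  beyond : ∀ i → i < suc j → f i ≡ column (suc j) s → nothing ≡ just (2 + i)
  beyond i i<1+j fi≡ = ⊥-elim (<-irrefl fi≡
    (<-≤-trans (bound i i<1+j) (≤-trans (*-monoʳ-≤ 2 i<1+j) (2*q≤column (suc j) s))))

-- does (c ≟ f j) computes to c ≡ᵇ f j, which with cannot abstract; hence the rewrites.
slotMatches-step : ∀ {f j c} t → IsPlacement f (suc j) → SlotMatches f j c t →
  SlotMatches f (suc j) c (graft (f j) (2 + j) (does (c ≟ f j)) t)
slotMatches-step {f} {j} {c} t V (toRoot , fromNode) with c ≟ f j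
... | yes refl rewrite dec-true (f j ≟ f j) refl | unoccupied⇒leaf t V refl fromNode =
  toRoot′ , λ _ → j , ≤-refl , refl
  where
  toRoot′ : ∀ i → i < suc j → f i ≡ f j → just (2 + j) ≡ just (2 + i)
  toRoot′ i i<1+j fi≡fj = cong (λ i → just (2 + i)) (sym (proj₂ V i j i<1+j ≤-refl fi≡fj))
... | no c≢fj rewrite dec-false (c ≟ f j) c≢fj = toRoot′ , fromNode′
  where
  toRoot′ : ∀ i → i < suc j → f i ≡ c → root (insert (f j) (2 + j) t) ≡ just (2 + i)
  toRoot′ i i<1+j fi≡c with m<1+n⇒m<n∨m≡n i<1+j
  ... | inj₁ i<j  = trans (root-insert t) (toRoot i i<j fi≡c)
  ... | inj₂ refl = ⊥-elim (c≢fj (sym fi≡c))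
  fromNode′ : IsNode (insert (f j) (2 + j) t) → ∃ λ i → i < suc j × f i ≡ c
  fromNode′ occupied with fromNode (isNode-insert⁻ t occupied)
  ... | i , i<j , fi≡c = i , m<n⇒m<1+n i<j , fi≡c

represents-base : ∀ f → Represents f 0 (node leaf 1 leaf)
represents-base f = (tt , tt , tt , tt) , ↭-refl , λ { zero z≤n → leaf , leaf , here leaf 1 leaf , empty }
  where
  empty : ∀ s → SlotMatches f 0 (column 0 s) (side s leaf leaf)
  empty false = (λ _ ()) , λ ()
  empty true  = (λ _ ()) , λ ()

represents-step : ∀ {f j T} → IsPlacement f (suc j) → Represents f j T →
  Represents f (suc j) (insert (f j) (2 + j) T)
represents-step {f} {j} {T} V R@(inc , lab , vertex) with nextRow-slot V R
... | q , s , fj≡ , l , r , p , empty = inc′ , lab′ , vertex′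
  where
  inc′ : Increasing (insert (f j) (2 + j) T)
  inc′ = graft-increasing false T inc λ x∈ → case ∈-vertices {T} lab x∈ of λ where
    (_ , q≤j , refl) → s≤s (s≤s q≤j)
  lab′ : labels (insert (f j) (2 + j) T) ↭ oneTo (2 + j)
  lab′ = ↭-trans (subst (λ c → labels (insert c (2 + j) T) ↭ 2 + j ∷ labels T) (sym fj≡)
                          (graft-labels s (distinct-oneTo lab) p empty))
                 (↭-trans (↭-prep (2 + j) lab) (↭-sym (oneTo-suc (suc j))))
  vertex′ : ∀ q′ → q′ ≤ suc j → VertexMatches f (suc j) (insert (f j) (2 + j) T) q′
  vertex′ q′ q′≤1+j with m≤n⇒m<n∨m≡n q′≤1+j
  ... | inj₂ refl = leaf , leaf ,
    subst (λ c → NodeAt (insert c (2 + j) T) (2 + j) leaf leaf) (sym fj≡) (graft-fills s p empty) ,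
    λ s′ → subst (SlotMatches f (suc j) (column (suc j) s′)) (sym (side-idem s′ leaf)) (slotMatches-new V s′)
  ... | inj₁ q′<1+j with vertex q′ (m<1+n⇒m≤n q′<1+j)
  ...   | l′ , r′ , p′ , matches = _ , _ , nodeAt-graft p′ , λ s′ →
    subst (SlotMatches f (suc j) (column q′ s′)) (sym (graft-side s′ (suc q′) l′ r′))
          (slotMatches-step (side s′ l′ r′) V (matches s′))

represents-build : ∀ {f} j → IsPlacement f j → Represents f j (build f j)
represents-build {f} zero    _ = represents-base f
represents-build     (suc j) V = represents-step V (represents-build j (isPlacement-pred V))

slotMatches-root : ∀ {f j c} t t′ → SlotMatches f j c t → SlotMatches f j c t′ → root t ≡ root t′
slotMatches-root leaf         leaf         _ _  = refl
slotMatches-root (node l a r) _            m m′ = viaOccupyingRow (proj₂ m (isNode l a r)) m m′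
  where
  viaOccupyingRow : ∀ {f j c t t′} → (∃ λ i → i < j × f i ≡ c) →
    SlotMatches f j c t → SlotMatches f j c t′ → root t ≡ root t′
  viaOccupyingRow (i , i<j , fi≡c) (toRoot , _) (toRoot′ , _) = trans (toRoot i i<j fi≡c) (sym (toRoot′ i i<j fi≡c))
slotMatches-root leaf         (node l a r) m m′ = sym (slotMatches-root (node l a r) leaf m′ m)

represents-unique : ∀ {f j T T′} → Represents f j T → Represents f j T′ → T ≡ T′
represents-unique {f} {j} {T} {T′} (inc , lab , vertex) (inc′ , lab′ , vertex′) =
  childRoots-ext (trans (root-oneTo inc lab) (sym (root-oneTo inc′ lab′))) sameChildRoots
  where
  sameChildRoots : ∀ {a l r l′ r′} → NodeAt T a l r → NodeAt T′ a l′ r′ → root l ≡ root l′ × root r ≡ root r′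
  sameChildRoots p p′ with ∈-vertices {T} lab (nodeAt⇒∈ p)
  ... | q , q≤j , refl with vertex q q≤j | vertex′ q q≤j
  ...   | _ , _ , p₀ , m | _ , _ , p₀′ , m′
          with nodeAt-unique (distinct-oneTo lab) p₀ p | nodeAt-unique (distinct-oneTo lab′) p₀′ p′
  ...     | refl , refl | refl , refl =
    slotMatches-root _ _ (m false) (m′ false) , slotMatches-root _ _ (m true) (m′ true)

represents-child : ∀ {f j T} → IsPlacement f j → Represents f j T →
  ∀ i → i < j → ∃₂ λ q s → f i ≡ column q s × ChildOf T (suc q) s (2 + i)
represents-child (bound , _) (_ , _ , vertex) i i<j with column-decode (bound i i<j)
... | q , s , q≤i , fi≡ with vertex q (≤-trans q≤i (<⇒≤ i<j))
...   | l , r , p , m = q , s , fi≡ , l , r , p , proj₁ (m s) i i<j fi≡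

represents-injective : ∀ {f g j T} → IsPlacement f j → IsPlacement g j → Represents f j T → Represents g j T →
  ∀ i → i < j → f i ≡ g i
represents-injective Vf Vg Rf@(_ , lab , _) Rg i i<j
  with represents-child Vf Rf i i<j | represents-child Vg Rg i i<j
... | q , s , fi≡ , c | q′ , s′ , gi≡ , c′ with childOf-unique (distinct-oneTo lab) c c′
...   | refl , refl = trans fi≡ (sym gi≡)

-- The default 0 never arises for i < n: vertex 2 + i then has a parent.
parentColumn : Tree → ℕ → ℕ
parentColumn T i = maybe′ (λ (a , s) → column (pred a) s) 0 (parent (2 + i) T)

parentColumn-child : ∀ {T q s i} → Distinct T → ChildOf T (suc q) s (2 + i) → parentColumn T i ≡ column q s
parentColumn-child d c rewrite childOf⇒parent d c = refl

module _ {T n} (inc : Increasing T) (lab : labels T ↭ oneTo (suc n)) where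

  private
    distinct : Distinct T
    distinct = distinct-oneTo lab

  vertex-parent : ∀ i → i < n → ∃₂ λ q s → q ≤ i × ChildOf T (suc q) s (2 + i)
  vertex-parent i i<n with childOf-exists (∈-resp-↭ (↭-sym lab) (∈-oneTo⁺ (s≤s i<n))) 1≢2+i
    where
    1≢2+i : root T ≢ just (2 + i)
    1≢2+i e with trans (sym (root-oneTo inc lab)) e
    ... | ()
  ... | a , s , c@(_ , _ , p , _) with ∈-vertices {T} lab (nodeAt⇒∈ p)
  ...   | q , _ , refl = q , s , m<1+n⇒m≤n (≤-pred (childOf-< inc c)) , c

  represents-parentColumn : Represents (parentColumn T) n T
  represents-parentColumn = inc , lab , vertex
    where
    vertex : ∀ q → q ≤ n → VertexMatches (parentColumn T) n T q
    vertex q q≤n with ∈⇒nodeAt (∈-resp-↭ (↭-sym lab) (∈-oneTo⁺ (s≤s q≤n)))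
    ... | l , r , p = l , r , p , λ s → toRoot s , fromNode s
      where
      toRoot : ∀ s i → i < n → parentColumn T i ≡ column q s → root (side s l r) ≡ just (2 + i)
      toRoot s i i<n fi≡ with vertex-parent i i<n
      ... | q′ , s′ , _ , c 
        with column-injective q′ s′ q s (trans (sym (parentColumn-child distinct c)) fi≡)
      ...   | refl , refl = childOf-at distinct p c
      fromNode : ∀ s → IsNode (side s l r) → ∃ λ i → i < n × parentColumn T i ≡ column q s
      fromNode s occupied with isNode-root occupied
      ... | x , e with ∈-vertices {T} lab (childOf⇒∈ (l , r , p , e)) | childOf-< inc (l , r , p , e)
      ...   | suc i , i<n , refl | _        = i , i<n , parentColumn-child distinct (l , r , p , e)
      ...   | zero  , _   , refl | s≤s ()

  isPlacement-parentColumn : IsPlacement (parentColumn T) n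
  isPlacement-parentColumn = bound , inj
    where
    bound : ∀ i → i < n → parentColumn T i < 2 * suc i
    bound i i<n with vertex-parent i i<n
    ... | q , s , q≤i , c rewrite parentColumn-child distinct c =
      <-≤-trans (column<2*[1+q] q s) (*-monoʳ-≤ 2 (s≤s q≤i))
    inj : ∀ i i′ → i < n → i′ < n → parentColumn T i ≡ parentColumn T i′ → i ≡ i′
    inj i i′ i<n i′<n f≡ with vertex-parent i i<n | vertex-parent i′ i′<n
    ... | q , s , _ , c | q′ , s′ , _ , c′
      with column-injective q s q′ s′
             (trans (sym (parentColumn-child distinct c)) (trans f≡ (parentColumn-child distinct c′)))
    ...   | refl , refl = +-cancelˡ-≡ 2 i i′ (childOf-functional distinct c c′)

module _ {T a l r} (distinct : Distinct T) (p : NodeAt T a l r) where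

  twoChildren⇔ : TwoChildren T a ⇔ (IsNode l × IsNode r)
  twoChildren⇔ = mk⇔ to′ (λ (nl , nr) → l , r , p , nl , nr)
    where
    to′ : TwoChildren T a → IsNode l × IsNode r
    to′ (_ , _ , p′ , nl , nr) with nodeAt-unique distinct p p′
    ... | refl , refl = nl , nr

  noChildren⇔ : NoChildren T a ⇔ (¬ IsNode l × ¬ IsNode r)
  noChildren⇔ =
    mk⇔ to′ (λ (¬nl , ¬nr) → subst₂ (NodeAt T a) (¬isNode⇒leaf l ¬nl) (¬isNode⇒leaf r ¬nr) p)
    where
    to′ : NoChildren T a → ¬ IsNode l × ¬ IsNode r
    to′ p′ with nodeAt-unique distinct p p′
    ... | refl , refl = ¬isNode-leaf , ¬isNode-leaf

  onlyLeftChild⇔ : OnlyLeftChild T a ⇔ (IsNode l × ¬ IsNode r)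
  onlyLeftChild⇔ = mk⇔ to′ (λ (nl , ¬nr) → l , subst (NodeAt T a l) (¬isNode⇒leaf r ¬nr) p , nl)
    where
    to′ : OnlyLeftChild T a → IsNode l × ¬ IsNode r
    to′ (_ , p′ , nl) with nodeAt-unique distinct p p′
    ... | refl , refl = nl , ¬isNode-leaf

  onlyRightChild⇔ : OnlyRightChild T a ⇔ (¬ IsNode l × IsNode r)
  onlyRightChild⇔ =
    mk⇔ to′ (λ (¬nl , nr) → r , subst (λ l′ → NodeAt T a l′ r) (¬isNode⇒leaf l ¬nl) p , nr)
    where
    to′ : OnlyRightChild T a → ¬ IsNode l × IsNode r
    to′ (_ , p′ , nr) with nodeAt-unique distinct p p′
    ... | refl , refl = ¬isNode-leaf , nr

blockMatchesVertex : ∀ {n T k l r} (v : Vec (Fin (2 * n)) n) → Distinct T → NodeAt T (suc k) l r →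
  BlockLeft v k ⇔ IsNode l → BlockRight v k ⇔ IsNode r → BlockMatchesVertex v T k
blockMatchesVertex v d p left⇔ right⇔ =
  ⇔-sym (twoChildren⇔ d p)    ⇔-∘ (left⇔ ×-⇔ right⇔) ,
  ⇔-sym (noChildren⇔ d p)     ⇔-∘ (¬-cong-⇔ left⇔ ×-⇔ ¬-cong-⇔ right⇔) ,
  ⇔-sym (onlyLeftChild⇔ d p)  ⇔-∘ (left⇔ ×-⇔ ¬-cong-⇔ right⇔) ,
  ⇔-sym (onlyRightChild⇔ d p) ⇔-∘ (¬-cong-⇔ left⇔ ×-⇔ right⇔)

rowColumn : ∀ {m n} → Vec (Fin m) n → ℕ → ℕ
rowColumn []      _       = 0
rowColumn (x ∷ v) zero    = toℕ x
rowColumn (x ∷ v) (suc i) = rowColumn v i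

rowColumn-lookup : ∀ {m n} (v : Vec (Fin m) n) j → rowColumn v (toℕ j) ≡ toℕ (lookup v j)
rowColumn-lookup (x ∷ v) Fin.zero    = refl
rowColumn-lookup (x ∷ v) (Fin.suc j) = rowColumn-lookup v j

rowColumn-fromℕ< : ∀ {m n} (v : Vec (Fin m) n) i (i<n : i < n) → rowColumn v i ≡ toℕ (lookup v (fromℕ< i<n))
rowColumn-fromℕ< v i i<n = trans (cong (rowColumn v) (sym (toℕ-fromℕ< i<n))) (rowColumn-lookup v (fromℕ< i<n))

isPlacement-rowColumn : ∀ {n} (R : R2δ n) → IsPlacement (rowColumn (proj₁ R)) n
isPlacement-rowColumn {n} (v , inDiagram , oneRookPerColumn) = bound , inj
  where
  bound : ∀ i → i < n → rowColumn v i < 2 * suc i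
  bound i i<n rewrite rowColumn-fromℕ< v i i<n =
    subst (λ i′ → toℕ (lookup v (fromℕ< i<n)) < 2 * suc i′) (toℕ-fromℕ< i<n) (inDiagram (fromℕ< i<n))
  inj : ∀ i i′ → i < n → i′ < n → rowColumn v i ≡ rowColumn v i′ → i ≡ i′
  inj i i′ i<n i′<n e = begin
    i                       ≡⟨ toℕ-fromℕ< i<n ⟨
    toℕ (fromℕ< i<n)        ≡⟨ cong toℕ (oneRookPerColumn _ _ (toℕ-injective (begin
      toℕ (lookup v (fromℕ< i<n))   ≡⟨ rowColumn-fromℕ< v i i<n ⟨
      rowColumn v i                 ≡⟨ e ⟩
      rowColumn v i′                ≡⟨ rowColumn-fromℕ< v i′ i′<n ⟩
      toℕ (lookup v (fromℕ< i′<n))  ∎))) ⟩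
    toℕ (fromℕ< i′<n)       ≡⟨ toℕ-fromℕ< i′<n ⟩
    i′                      ∎
    where open ≡-Reasoning

module _ {f n} (V : IsPlacement f n) where

  private
    f<2n : ∀ (j : Fin n) → f (toℕ j) < 2 * n
    f<2n j = <-≤-trans (proj₁ V (toℕ j) (toℕ<n j)) (*-monoʳ-≤ 2 (toℕ<n j))

    rows : Vec (Fin (2 * n)) n
    rows = tabulate (λ j → fromℕ< (f<2n j))

    lookup-rows : ∀ j → toℕ (lookup rows j) ≡ f (toℕ j)
    lookup-rows j = trans (cong toℕ (lookup∘tabulate _ j)) (toℕ-fromℕ< (f<2n j))

  placement : R2δ n
  placement = rows , inDiagram , oneRookPerColumn
    where
    inDiagram : InDiagram rows
    inDiagram j rewrite lookup-rows j = proj₁ V (toℕ j) (toℕ<n j)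
    oneRookPerColumn : AtMostOnePerColumn rows
    oneRookPerColumn j j′ e = toℕ-injective (proj₂ V (toℕ j) (toℕ j′) (toℕ<n j) (toℕ<n j′)
      (trans (sym (lookup-rows j)) (trans (cong toℕ e) (lookup-rows j′))))

  rowColumn-placement : ∀ i → i < n → rowColumn (proj₁ placement) i ≡ f i
  rowColumn-placement i i<n =
    trans (rowColumn-fromℕ< rows i i<n) (trans (lookup-rows (fromℕ< i<n)) (cong f (toℕ-fromℕ< i<n)))

Φ : ∀ n → R2δ n → IBT (suc n)
Φ n R = build (rowColumn (proj₁ R)) n , proj₁ represents , proj₁ (proj₂ represents)
  where
  represents : Represents (rowColumn (proj₁ R)) n (build (rowColumn (proj₁ R)) n)
  represents = represents-build n (isPlacement-rowColumn R)

Φ-injective : ∀ n (R R′ : R2δ n) → proj₁ (Φ n R) ≡ proj₁ (Φ n R′) → proj₁ R ≡ proj₁ R′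
Φ-injective n (v , R) (v′ , R′) e = begin
  v                      ≡⟨ tabulate∘lookup v ⟨
  tabulate (lookup v)    ≡⟨ tabulate-cong (λ j → toℕ-injective (sameColumn j)) ⟩
  tabulate (lookup v′)   ≡⟨ tabulate∘lookup v′ ⟩
  v′                     ∎
  where
  open ≡-Reasoning
  V  = isPlacement-rowColumn (v , R)
  V′ = isPlacement-rowColumn (v′ , R′)
  sameColumn : ∀ j → toℕ (lookup v j) ≡ toℕ (lookup v′ j)
  sameColumn j = trans (sym (rowColumn-lookup v j)) (trans
    (represents-injective V V′ (represents-build n V) (subst (Represents _ n) (sym e) (represents-build n V′))
      (toℕ j) (toℕ<n j))
    (rowColumn-lookup v′ j))

Φ-surjective : ∀ n (T : IBT (suc n)) → ∃[ R ] proj₁ (Φ n R) ≡ proj₁ T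
Φ-surjective n (T , inc , lab) = placement V , trans
  (build-cong n (rowColumn-placement V))
  (represents-unique (represents-build n V) (represents-parentColumn inc lab))
  where
  V = isPlacement-parentColumn inc lab

Φ-blocks : ∀ n (R : R2δ n) (i : Fin n) → BlockMatchesVertex (proj₁ R) (proj₁ (Φ n R)) (toℕ i)
Φ-blocks n R@(v , _) i with represents-build n (isPlacement-rowColumn R)
... | _ , lab , vertex with vertex (toℕ i) (<⇒≤ (toℕ<n i))
...   | l , r , p , matches =
  blockMatchesVertex v (distinct-oneTo lab) p (rookInColumn⇔ (matches false)) (rookInColumn⇔ (matches true))
  where
  rookInColumn⇔ : ∀ {c t} → SlotMatches (rowColumn v) n c t → RookInColumn v c ⇔ IsNode t
  rookInColumn⇔ (toRoot , occupied) = mk⇔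
    (λ (j , e) → root⇒isNode (toRoot (toℕ j) (toℕ<n j) (trans (rowColumn-lookup v j) e)))
    (λ isNode → case occupied isNode of λ where
      (i , i<n , e) → fromℕ< i<n , trans (sym (rowColumn-fromℕ< v i i<n)) e)

theorem1p1 : (n : ℕ) → 1 ≤ n →
    Σ (R2δ n → IBT (suc n)) λ Φ →
      (∀ (R R' : R2δ n) → proj₁ (Φ R) ≡ proj₁ (Φ R') → proj₁ R ≡ proj₁ R')
      × (∀ (T : IBT (suc n)) → ∃[ R ] proj₁ (Φ R) ≡ proj₁ T)
      × (∀ (R : R2δ n) (i : Fin n) →
           BlockMatchesVertex (proj₁ R) (proj₁ (Φ R)) (toℕ i))
theorem1p1 n _ = Φ n , Φ-injective n , Φ-surjective n , Φ-blocks n
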